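{- Let $n \geq 2$ and $1 \leq a \leq n/2$ be integers such that $f(n) = f(a) + f(n-a)$, and let $c > 0$ be defined by $f(n) = c \log_3(n)$. Then $a \leq 2 n^{c/3 - 1}$.
   Context: For a positive integer $n$, the complexity $f(n)$ is the least number of $1$'s needed to write $n$ using $1$'s together with an arbitrary number of additions, multiplications and parentheses. $\log_3$ denotes the logarithm in base $3$. -}

module Defs where

open import Data.Nat using (ℕ; zero; suc; _+_; _*_; _≤_)
open import Data.Product using (Σ; _×_)
open import Relation.Binary.PropositionalEquality using (_≡_)

data Expr : Set where
  one : Expr
  _⊕_ : Expr → Expr → Expr
  _⊗_ : Expr → Expr → Expr

eval : Expr → ℕ
eval one       = 1
eval (e ⊕ e′)  = eval e + eval e′
eval (e ⊗ e′)  = eval e * eval e′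

ones : Expr → ℕ
ones one       = 1
ones (e ⊕ e′)  = ones e + ones e′
ones (e ⊗ e′)  = ones e + ones e′

-- Complexity n k  :⇔  f(n) = k, i.e. k is the least number of 1's in an
-- expression with value n.
Complexity : ℕ → ℕ → Set
Complexity n k =
  Σ Expr (λ e → eval e ≡ n × ones e ≡ k) × (∀ (e : Expr) → eval e ≡ n → k ≤ ones e)

{-# OPTIONS --safe #-}
module Submission where

-- By induction on expressions, (eval e)³ ≤ 3 ^ ones e, i.e. m ≤ 3^(f(m)/3). For a sum x + y with x ≤ y, (x + y)³ ≤ 8 y³ is
-- absorbed by the factor 3 ^ ones ≥ 9 of the smaller summand, unless that
-- summand is a single 1, where (1 + y)³ ≤ 3 y³ for y ≥ 3.
-- Since n ≤ 2(n − a), this gives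
-- (a n)³ ≤ 8 (a (n − a))³ ≤ 8 · 3 ^ (f(a) + f(n − a)) = 8 · 3 ^ f(n),
-- the cube of a n ≤ 2 n^(c/3).

open import Defs
open import Data.Nat using (ℕ; suc; _+_; _*_; _∸_; _^_; _≤_; z≤n; s≤s)
open import Data.Nat.Properties
open import Data.Nat.Solver using (module +-*-Solver)
open import Algebra.Properties.CommutativeSemigroup *-commutativeSemigroup using (x∙yz≈y∙xz)
open import Data.Product using (_,_)
open import Data.Sum using (inj₁; inj₂)
open import Relation.Binary.PropositionalEquality using (_≡_; refl; sym; cong)
open import Relation.Nullary using (contradiction)

open +-*-Solver
open ≤-Reasoning

^3-distribʳ-* : ∀ x y → (x * y) ^ 3 ≡ x ^ 3 * y ^ 3
^3-distribʳ-* = solve 2 (λ x y → (x :* y) :^ 3 := x :^ 3 :* y :^ 3) refl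

[2*x]^3≡8*x^3 : ∀ x → (2 * x) ^ 3 ≡ 8 * x ^ 3
[2*x]^3≡8*x^3 = solve 1 (λ x → (con 2 :* x) :^ 3 := con 8 :* x :^ 3) refl

[x+y]^3≤8*y^3 : ∀ {x y} → x ≤ y → (x + y) ^ 3 ≤ 8 * y ^ 3
[x+y]^3≤8*y^3 {x} {y} x≤y = begin
  (x + y) ^ 3   ≤⟨ ^-monoˡ-≤ 3 (+-mono-≤ x≤y (m≤m+n y 0)) ⟩
  (2 * y) ^ 3   ≡⟨ [2*x]^3≡8*x^3 y ⟩
  8 * y ^ 3     ∎

[1+y]^3≤3*y^3 : ∀ {y} → 3 ≤ y → (1 + y) ^ 3 ≤ 3 * y ^ 3
[1+y]^3≤3*y^3 {1} (s≤s ())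
[1+y]^3≤3*y^3 {2} (s≤s (s≤s ()))
[1+y]^3≤3*y^3 {suc (suc (suc k))} _ = begin
  (4 + k) ^ 3                                                  ≤⟨ m≤m+n _ _ ⟩
  (4 + k) ^ 3 + (17 + 33 * k + 15 * k ^ 2 + 2 * k ^ 3)         ≡⟨ sym (expand k) ⟩
  3 * (3 + k) ^ 3                                              ∎
  where
  expand : ∀ k → 3 * (3 + k) ^ 3 ≡ (4 + k) ^ 3 + (17 + 33 * k + 15 * k ^ 2 + 2 * k ^ 3)
  expand = solve 1 (λ k → con 3 :* (con 3 :+ k) :^ 3
                        := (con 4 :+ k) :^ 3 :+ (con 17 :+ con 33 :* k :+ con 15 :* k :^ 2 :+ con 2 :* k :^ 3))
                   refl

9≤3^[2+a] : ∀ a → 9 ≤ 3 ^ (2 + a)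
9≤3^[2+a] a = ^-monoʳ-≤ 3 (s≤s (s≤s (z≤n {a})))

sum-cube-bound-ordered : ∀ {x y a b} → x ≤ y → 1 ≤ a → 1 ≤ b →
  x ^ 3 ≤ 3 ^ a → y ^ 3 ≤ 3 ^ b → (x + y) ^ 3 ≤ 3 ^ a * 3 ^ b
sum-cube-bound-ordered {a = 0} _ () _ _ _
sum-cube-bound-ordered {x} {y} {suc (suc a)} {b} x≤y _ _ _ y³≤3^b = begin
  (x + y) ^ 3           ≤⟨ [x+y]^3≤8*y^3 x≤y ⟩
  8 * y ^ 3             ≤⟨ *-mono-≤ (≤-trans (n≤1+n 8) (9≤3^[2+a] a)) y³≤3^b ⟩
  3 ^ (2 + a) * 3 ^ b   ∎
sum-cube-bound-ordered {suc (suc x)} {a = 1} _ _ _ x³≤3 _ =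
  contradiction (≤-trans (^-monoˡ-≤ 3 (m≤m+n 2 x)) x³≤3) λ { (s≤s (s≤s (s≤s ()))) }
sum-cube-bound-ordered {0} {a = 1} {b} _ _ _ _ y³≤3^b = ≤-trans y³≤3^b (m≤n*m (3 ^ b) 3)
sum-cube-bound-ordered {1} {0} ()
sum-cube-bound-ordered {1} {1} {1} _ _ 1≤b _ _ = ≤-trans (n≤1+n 8) (*-monoʳ-≤ 3 (^-monoʳ-≤ 3 1≤b))
sum-cube-bound-ordered {1} {2} {1} {0} _ _ _ _ (s≤s ())
sum-cube-bound-ordered {1} {2} {1} {1} _ _ _ _ (s≤s (s≤s (s≤s ())))
sum-cube-bound-ordered {1} {2} {1} {suc (suc b)} _ _ _ _ _ = *-monoʳ-≤ 3 (9≤3^[2+a] b)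
sum-cube-bound-ordered {1} {y@(suc (suc (suc _)))} {1} _ _ _ _ y³≤3^b =
  ≤-trans ([1+y]^3≤3*y^3 {y} (s≤s (s≤s (s≤s z≤n)))) (*-monoʳ-≤ 3 y³≤3^b)

sum-cube-bound : ∀ x y a b → 1 ≤ a → 1 ≤ b →
  x ^ 3 ≤ 3 ^ a → y ^ 3 ≤ 3 ^ b → (x + y) ^ 3 ≤ 3 ^ (a + b)
sum-cube-bound x y a b 1≤a 1≤b x³≤3^a y³≤3^b with ≤-total x y
... | inj₁ x≤y = begin
  (x + y) ^ 3     ≤⟨ sum-cube-bound-ordered x≤y 1≤a 1≤b x³≤3^a y³≤3^b ⟩
  3 ^ a * 3 ^ b   ≡⟨ sym (^-distribˡ-+-* 3 a b) ⟩
  3 ^ (a + b)     ∎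
... | inj₂ y≤x = begin
  (x + y) ^ 3     ≡⟨ cong (_^ 3) (+-comm x y) ⟩
  (y + x) ^ 3     ≤⟨ sum-cube-bound-ordered y≤x 1≤b 1≤a y³≤3^b x³≤3^a ⟩
  3 ^ b * 3 ^ a   ≡⟨ sym (^-distribˡ-+-* 3 b a) ⟩
  3 ^ (b + a)     ≡⟨ cong (3 ^_) (+-comm b a) ⟩
  3 ^ (a + b)     ∎

product-cube-bound : ∀ x y a b →
  x ^ 3 ≤ 3 ^ a → y ^ 3 ≤ 3 ^ b → (x * y) ^ 3 ≤ 3 ^ (a + b)
product-cube-bound x y a b x³≤3^a y³≤3^b = begin
  (x * y) ^ 3     ≡⟨ ^3-distribʳ-* x y ⟩
  x ^ 3 * y ^ 3   ≤⟨ *-mono-≤ x³≤3^a y³≤3^b ⟩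
  3 ^ a * 3 ^ b   ≡⟨ sym (^-distribˡ-+-* 3 a b) ⟩
  3 ^ (a + b)     ∎

ones-positive : ∀ e → 1 ≤ ones e
ones-positive one      = ≤-refl
ones-positive (e ⊕ e′) = ≤-trans (ones-positive e) (m≤m+n (ones e) (ones e′))
ones-positive (e ⊗ e′) = ≤-trans (ones-positive e) (m≤m+n (ones e) (ones e′))

eval^3≤3^ones : ∀ e → eval e ^ 3 ≤ 3 ^ ones e
eval^3≤3^ones one      = s≤s z≤n
eval^3≤3^ones (e ⊕ e′) =
  sum-cube-bound (eval e) (eval e′) (ones e) (ones e′)
    (ones-positive e) (ones-positive e′) (eval^3≤3^ones e) (eval^3≤3^ones e′)
eval^3≤3^ones (e ⊗ e′) =
  product-cube-bound (eval e) (eval e′) (ones e) (ones e′) (eval^3≤3^ones e) (eval^3≤3^ones e′)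

complexity-cube-bound : ∀ {m k} → Complexity m k → m ^ 3 ≤ 3 ^ k
complexity-cube-bound ((e , refl , refl) , _) = eval^3≤3^ones e

n≤2*[n∸a] : ∀ n a → 2 * a ≤ n → n ≤ 2 * (n ∸ a)
n≤2*[n∸a] n a 2a≤n = begin
  n                   ≤⟨ m≤n+m∸n n a ⟩
  a + (n ∸ a)         ≤⟨ +-mono-≤ a≤n∸a (m≤m+n (n ∸ a) 0) ⟩
  2 * (n ∸ a)         ∎
  where
  a≤n∸a : a ≤ n ∸ a
  a≤n∸a = m+n≤o⇒m≤o∸n a (≤-trans (+-monoʳ-≤ a (m≤m+n a 0)) 2a≤n)

mainTheorem3 : ∀ (n a fn fa fna : ℕ) →
    2 ≤ n → 1 ≤ a → 2 * a ≤ n →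
    Complexity n fn → Complexity a fa → Complexity (n ∸ a) fna →
    fn ≡ fa + fna →
    (a * n) ^ 3 ≤ 8 * 3 ^ fn
mainTheorem3 n a fn fa fna _ _ 2a≤n _ ca cna refl = begin
  (a * n) ^ 3               ≤⟨ ^-monoˡ-≤ 3 (*-monoʳ-≤ a (n≤2*[n∸a] n a 2a≤n)) ⟩
  (a * (2 * (n ∸ a))) ^ 3   ≡⟨ cong (_^ 3) (x∙yz≈y∙xz a 2 (n ∸ a)) ⟩
  (2 * (a * (n ∸ a))) ^ 3   ≡⟨ [2*x]^3≡8*x^3 (a * (n ∸ a)) ⟩
  8 * (a * (n ∸ a)) ^ 3     ≤⟨ *-monoʳ-≤ 8 (product-cube-bound a (n ∸ a) fa fna
                                (complexity-cube-bound ca) (complexity-cube-bound cna)) ⟩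
  8 * 3 ^ (fa + fna)        ∎
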